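{- Let $e_1,e_2$ be integers with $e_1\ge e_2>1$ and let $P=\{t_1=\{a^{e_1}\},t_2=\{\hat a^{e_2}\},t_3=\{\hat a\}\}$. Let $(R_1,R_2,R_3)$ be a tile distribution of some graph realized by $P$. If $1+R_2(e_2-1)\ge R_1$, then there exists a connected graph realized by $P$ with tile distribution $(R_1,R_2,R_3)$.
   Context: Graphs are loopless multigraphs. A tile is a vertex with half-edges (cohesive ends) labeled by letters; $\{a^{e}\}$ denotes a tile with $e$ cohesive ends of type $a$, and $\{\hat a^{e}\}$ a tile with $e$ cohesive ends of the complementary type $\hat a$. A pot is a set of tile types. A graph $G$ is realized by a pot $P$ if each vertex $v$ can be assigned a tile type $t\in P$ together with a bijection between the cohesive ends of $t$ and the edge-ends (half-edges) at $v$, such that for every edge the two half-edges are assigned complementary cohesive ends ($a$ and $\hat a$). The tile distribution $(R_1,R_2,R_3)$ of such a realization records that exactly $R_k$ vertices are assigned tile type $t_k$. -}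

module Defs where

open import Data.Nat using (ℕ; zero; suc; _+_; _*_; _∸_; _≤_)
open import Data.Bool using (Bool; true; false; not)
open import Data.Fin using (Fin; zero; suc)
open import Data.Fin.Properties using (_≟_)
open import Data.List using (List; replicate; length; allFin; filter) renaming (_∷_ to _L∷_; [] to L[])
open import Data.Vec using (Vec; lookup; _∷_; [])
open import Data.Product using (Σ; ∃; _×_; _,_; proj₁; proj₂)
open import Data.Sum using (_⊎_)
open import Relation.Binary.PropositionalEquality using (_≡_; _≢_)
open import Relation.Binary.Construct.Closure.ReflexiveTransitive using (Star)
open import Function.Bundles using (_↔_; Inverse)

-- Loopless multigraph: vertices Fin n, edges Fin m, each edge has an
-- ordered pair of (distinct) endpoints; side false/true of edge i are its
-- two half-edges.
record Graph : Set where
  field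
    n        : ℕ
    m        : ℕ
    ends     : Fin m → Fin n × Fin n
    loopless : ∀ i → proj₁ (ends i) ≢ proj₂ (ends i)

open Graph public

endpoint : (G : Graph) → Fin (m G) × Bool → Fin (n G)
endpoint G (i , false) = proj₁ (ends G i)
endpoint G (i , true)  = proj₂ (ends G i)

HalfEdgeAt : (G : Graph) → Fin (n G) → Set
HalfEdgeAt G v = Σ (Fin (m G) × Bool) (λ h → endpoint G h ≡ v)

-- cohesive-end types: a letter (ℕ) together with a hat flag (true = hatted)
CohesiveEnd : Set
CohesiveEnd = ℕ × Bool

complementary : CohesiveEnd → CohesiveEnd → Set
complementary (x , b) (y , c) = x ≡ y × c ≡ not b

-- a tile is a (multi)set of cohesive ends, listed
Tile : Set
Tile = List CohesiveEnd

endAt : (t : Tile) → Fin (length t) → CohesiveEnd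
endAt t k = Data.List.lookup t k

record Realization {k : ℕ} (P : Vec Tile k) (G : Graph) : Set where
  field
    tileOf : Fin (n G) → Fin k
    assign : (v : Fin (n G)) → Fin (length (lookup P (tileOf v))) ↔ HalfEdgeAt G v
  endOf : (h : Fin (m G) × Bool) → CohesiveEnd
  endOf h = endAt (lookup P (tileOf (endpoint G h)))
                  (Inverse.from (assign (endpoint G h)) (h , Relation.Binary.PropositionalEquality.refl))
  field
    matching : ∀ i → complementary (endOf (i , false)) (endOf (i , true))

open Realization public

countTile : {k : ℕ} {P : Vec Tile k} {G : Graph} → Realization P G → Fin k → ℕ
countTile {G = G} ρ j = length (filter (λ v → tileOf ρ v ≟ j) (allFin (n G)))

HasDistribution : {P : Vec Tile 3} {G : Graph} → Realization P G → ℕ → ℕ → ℕ → Set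
HasDistribution ρ R₁ R₂ R₃ =
  countTile ρ zero ≡ R₁ × countTile ρ (suc zero) ≡ R₂ × countTile ρ (suc (suc zero)) ≡ R₃

Adjacent : (G : Graph) → Fin (n G) → Fin (n G) → Set
Adjacent G u v = ∃ λ i → ends G i ≡ (u , v) ⊎ ends G i ≡ (v , u)

Connected : Graph → Set
Connected G = ∀ u v → Star (Adjacent G) u v

a : CohesiveEnd
a = (0 , false)

â : CohesiveEnd
â = (0 , true)

pot : ℕ → ℕ → Vec Tile 3
pot e₁ e₂ = replicate e₁ a ∷ replicate e₂ â ∷ (â L∷ L[]) ∷ []

{-# OPTIONS --safe #-}
-- Every edge has exactly one a-end and one â-end, so counting the ends of each kind shows that
-- any realization satisfies R₁ e₁ = R₂ e₂ + R₃. Conversely, any bijection between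
-- the a-ends Fin R₁ × Fin e₁ and the â-ends (Fin R₂ × Fin e₂) ⊎ Fin R₃ defines a bipartite
-- graph realized by the pot with distribution (R₁, R₂, R₃); the work is to choose one whose
-- graph is connected. Write R₁ = 1 + L, d = e₂ − 1 and K = min(L, R₂), so that L ≤ K d is
-- exactly the hypothesis R₁ ≤ 1 + R₂ d. Among the R₂ vertices of tile {â^e₂} (blocks), the
-- first K become hubs: hub w takes the second end of a-vertex w and the first ends of the
-- a-vertices 1 + (w d + l), l < d.
-- Since L ≤ K d, every a-vertex p + 1 hangs from the hub ⌊p / d⌋, whose own a-vertex has
-- smaller index, so all a-vertices are connected to a-vertex 0. The remaining ends on both
-- sides are equally many and are matched arbitrarily; every â-vertex then touches some
-- a-vertex, which gives connectivity.
module Submission where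

open import Defs
open import Axiom.UniquenessOfIdentityProofs.WithK using (uip)
open import Data.Bool using (Bool; true; false; not)
open import Data.Empty using (⊥; ⊥-elim)
open import Data.Fin using (Fin; zero; suc; toℕ; cast; _↑ˡ_; remQuot; combine)
open import Data.Fin.Permutation using (↔⇒≡)
open import Data.Fin.Properties
  using (_≟_; +↔⊎; *↔×; 1↔⊤; cast-involutive; toℕ-cast; toℕ-↑ˡ; toℕ-combine; combine-remQuot)
open import Data.List as List using (_∷_; []; length; filter; tabulate; replicate)
open import Data.List.Properties using (length-replicate; lookup-replicate)
open import Data.Nat using (ℕ; zero; suc; _+_; _*_; _∸_; _≤_; _<_; _⊓_; z≤n; s≤s; +-0-rawMonoid)
open import Algebra.Definitions.RawMonoid +-0-rawMonoid using (sum)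
open import Data.Nat.Properties
  using ( ≤-trans; ≤-<-trans; ≤-reflexive; n≤1+n; m≤m+n; m≤m*n; +-cancelˡ-≡; m+[n∸m]≡n
        ; m⊓n≤m; m⊓n≤n; ⊓-glb; *-distribʳ-⊓; m+n≡0⇒m≡0; m+n≡0⇒n≡0; m*n≡0⇒m≡0
        ; module ≤-Reasoning)
open import Data.Nat.Tactic.RingSolver using (solve)
open import Data.Product using (Σ; ∃; _×_; _,_; proj₁; proj₂)
open import Data.Product.Algebra using (×-distribʳ-⊎)
open import Data.Product.Function.Dependent.Propositional using (Σ-↔)
open import Data.Product.Function.NonDependent.Propositional using (_×-↔_)
open import Data.Sum using (_⊎_; inj₁; inj₂; map)
open import Data.Sum.Function.Propositional using (_⊎-↔_)
open import Data.Unit using (⊤; tt)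
open import Data.Vec using (lookup)
open import Function using (_∘_; id)
open import Function.Bundles using (_↔_; Inverse; mk↔ₛ′)
open import Function.Properties.Inverse using (↔-refl; ↔-sym; ↔-trans)
open import Function.Related.Propositional using (module EquationalReasoning)
open import Level using (0ℓ)
open import Relation.Binary.Construct.Closure.ReflexiveTransitive using (Star; ε; _◅_; _◅◅_; reverse)
open import Relation.Binary.PropositionalEquality
open import Relation.Nullary using (¬_; yes; no)
open import Relation.Unary using (Decidable)

private variable
  A B C D E : Set

Fiber : (A → B) → B → Set
Fiber {A} f y = Σ A λ x → f x ≡ y

≡-↔ : {x y : A} {u v : B} → (x ≡ y → u ≡ v) → (u ≡ v → x ≡ y) → (x ≡ y) ↔ (u ≡ v)
≡-↔ f g = mk↔ₛ′ f g (λ _ → uip _ _) (λ _ → uip _ _)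

¬⇒↔⊥ : ¬ A → A ↔ ⊥
¬⇒↔⊥ ¬x = mk↔ₛ′ ¬x (λ ()) (λ ()) (λ x → ⊥-elim (¬x x))

contractible⇒↔⊤ : (c : A) → (∀ x → c ≡ x) → A ↔ ⊤
contractible⇒↔⊤ c unique = mk↔ₛ′ _ (λ _ → c) (λ _ → refl) unique

⊥-⊎↔ : (⊥ ⊎ A) ↔ A
⊥-⊎↔ = mk↔ₛ′ (λ { (inj₂ x) → x ; (inj₁ ()) }) inj₂
  (λ _ → refl) (λ { (inj₂ _) → refl ; (inj₁ ()) })

×-⊤↔ : (A × ⊤) ↔ A
×-⊤↔ = mk↔ₛ′ proj₁ (_, tt) (λ _ → refl) (λ _ → refl)

×-≡-refl↔ : ∀ {b : Bool} → (A × (b ≡ b)) ↔ A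
×-≡-refl↔ = mk↔ₛ′ proj₁ (_, refl) (λ _ → refl) (λ { (_ , refl) → refl })

×-≢↔Fin0 : ∀ {b β : Bool} → ¬ (b ≡ β) → (A × (b ≡ β)) ↔ Fin 0
×-≢↔Fin0 b≢β = mk↔ₛ′ (λ (_ , p) → ⊥-elim (b≢β p)) (λ ()) (λ ()) (λ (_ , p) → ⊥-elim (b≢β p))

≡⊎not≡↔⊤ : ∀ b β → ((b ≡ β) ⊎ (not b ≡ β)) ↔ ⊤
≡⊎not≡↔⊤ false false = contractible⇒↔⊤ (inj₁ refl) λ { (inj₁ refl) → refl ; (inj₂ ()) }
≡⊎not≡↔⊤ false true  = contractible⇒↔⊤ (inj₂ refl) λ { (inj₁ ()) ; (inj₂ refl) → refl }
≡⊎not≡↔⊤ true  false = contractible⇒↔⊤ (inj₂ refl) λ { (inj₁ ()) ; (inj₂ refl) → refl }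
≡⊎not≡↔⊤ true  true  = contractible⇒↔⊤ (inj₁ refl) λ { (inj₁ refl) → refl ; (inj₂ ()) }

inj₁-side↔ : {x x′ : A} {y : B} →
  (x ≡ x′) ↔ (_≡_ {A = A ⊎ B} (inj₁ x) (inj₁ x′) ⊎ _≡_ {A = A ⊎ B} (inj₂ y) (inj₁ x′))
inj₁-side↔ = mk↔ₛ′ (λ { refl → inj₁ refl }) (λ { (inj₁ refl) → refl ; (inj₂ ()) })
  (λ { (inj₁ refl) → refl ; (inj₂ ()) }) (λ { refl → refl })

inj₂-side↔ : {x : A} {y y′ : B} →
  (y ≡ y′) ↔ (_≡_ {A = A ⊎ B} (inj₁ x) (inj₂ y′) ⊎ _≡_ {A = A ⊎ B} (inj₂ y) (inj₂ y′))
inj₂-side↔ = mk↔ₛ′ (λ { refl → inj₂ refl }) (λ { (inj₂ refl) → refl ; (inj₁ ()) })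
  (λ { (inj₂ refl) → refl ; (inj₁ ()) }) (λ { refl → refl })

Σ-×-Bool↔ : (P : A × Bool → Set) → Σ (A × Bool) P ↔ Σ A (λ x → P (x , false) ⊎ P (x , true))
Σ-×-Bool↔ P = mk↔ₛ′
  (λ { ((x , false) , p) → x , inj₁ p ; ((x , true) , p) → x , inj₂ p })
  (λ { (x , inj₁ p) → (x , false) , p ; (x , inj₂ p) → (x , true) , p })
  (λ { (_ , inj₁ _) → refl ; (_ , inj₂ _) → refl })
  (λ { ((_ , false) , _) → refl ; ((_ , true) , _) → refl })

Σ-Fin-suc↔ : ∀ {k} (P : Fin (suc k) → Set) → Σ (Fin (suc k)) P ↔ (P zero ⊎ Σ (Fin k) (P ∘ suc))
Σ-Fin-suc↔ P = mk↔ₛ′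
  (λ { (zero , p) → inj₁ p ; (suc j , p) → inj₂ (j , p) })
  (λ { (inj₁ p) → zero , p ; (inj₂ (j , p)) → suc j , p })
  (λ { (inj₁ _) → refl ; (inj₂ _) → refl })
  (λ { (zero , _) → refl ; (suc _ , _) → refl })

Σ-∘-fibres↔ : (f : A → B) (C : B → Set) → Σ A (C ∘ f) ↔ Σ B (λ y → Fiber f y × C y)
Σ-∘-fibres↔ f C = mk↔ₛ′ (λ (x , c) → f x , (x , refl) , c) (λ { (_ , (x , refl) , c) → x , c })
  (λ { (_ , (_ , refl) , _) → refl }) (λ { (_ , _) → refl })

Σ-fibres↔ : (f : A → B) (P : A → Set) → Σ A P ↔ Σ B (λ y → Σ (Fiber f y) (P ∘ proj₁))
Σ-fibres↔ f P = mk↔ₛ′ (λ (x , p) → f x , (x , refl) , p) (λ (_ , (x , _) , p) → x , p)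
  (λ { (_ , (_ , refl) , _) → refl }) (λ { (_ , _) → refl })

Fiber-∘↔ : (φ : A ↔ B) (f : B → C) (y : C) → Fiber (f ∘ Inverse.to φ) y ↔ Fiber f y
Fiber-∘↔ φ f y = Σ-↔ φ ↔-refl

Fiber-proj₁↔ : (x : A) → Fiber (proj₁ {A = A} {B = λ _ → B}) x ↔ B
Fiber-proj₁↔ x = mk↔ₛ′ (λ { ((_ , y) , _) → y }) (λ y → (x , y) , refl)
  (λ _ → refl) (λ { (_ , refl) → refl })

Fin-suc↔ : ∀ {k} → Fin (suc k) ↔ (⊤ ⊎ Fin k)
Fin-suc↔ = ↔-trans +↔⊎ (1↔⊤ ⊎-↔ ↔-refl)

×-Fin-suc↔ : ∀ {k} → (A × Fin (suc k)) ↔ (A ⊎ (A × Fin k))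
×-Fin-suc↔ = mk↔ₛ′
  (λ { (x , zero) → inj₁ x ; (x , suc j) → inj₂ (x , j) })
  (λ { (inj₁ x) → x , zero ; (inj₂ (x , j)) → x , suc j })
  (λ { (inj₁ _) → refl ; (inj₂ _) → refl })
  (λ { (_ , zero) → refl ; (_ , suc _) → refl })

cast-↔ : ∀ {k l} → k ≡ l → Fin k ↔ Fin l
cast-↔ eq = mk↔ₛ′ (cast eq) (cast (sym eq)) (cast-involutive eq (sym eq)) (cast-involutive (sym eq) eq)

Σ-Fin↔sum : ∀ {k} (g : Fin k → ℕ) → Σ (Fin k) (Fin ∘ g) ↔ Fin (sum g)
Σ-Fin↔sum {zero}  g = mk↔ₛ′ (λ ()) (λ ()) (λ ()) (λ ())
Σ-Fin↔sum {suc k} g =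
  ↔-trans (Σ-Fin-suc↔ _) (↔-trans (↔-refl ⊎-↔ Σ-Fin↔sum (g ∘ suc)) (↔-sym +↔⊎))

filter-tabulate↔Σ : ∀ {n} {P : A → Set} (P? : Decidable P) → (∀ {x} (p q : P x) → p ≡ q) →
  (g : Fin n → A) → Fin (length (filter P? (tabulate g))) ↔ Σ (Fin n) (P ∘ g)
filter-tabulate↔Σ {n = zero}  P? irr g = mk↔ₛ′ (λ ()) (λ ()) (λ ()) (λ ())
filter-tabulate↔Σ {n = suc n} P? irr g with P? (g zero)
... | yes p = ↔-trans Fin-suc↔ (↔-trans
  (↔-sym (contractible⇒↔⊤ p (irr p)) ⊎-↔ filter-tabulate↔Σ P? irr (g ∘ suc)) (↔-sym (Σ-Fin-suc↔ _)))
... | no ¬p = ↔-trans (↔-sym ⊥-⊎↔) (↔-trans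
  (↔-sym (¬⇒↔⊥ ¬p) ⊎-↔ filter-tabulate↔Σ P? irr (g ∘ suc)) (↔-sym (Σ-Fin-suc↔ _)))

lookup-replicate′ : ∀ n (x : A) k → List.lookup (replicate n x) k ≡ x
lookup-replicate′ n x k = begin
  List.lookup (replicate n x) k
    ≡⟨ cong (List.lookup (replicate n x)) (cast-involutive (sym eq) eq k) ⟨
  List.lookup (replicate n x) (cast (sym eq) (cast eq k))
    ≡⟨ lookup-replicate n x (cast eq k) ⟩
  x ∎
  where
  open ≡-Reasoning
  eq = length-replicate n

toℕ-quotient≤ : ∀ {K} k (i : Fin (K * suc k)) → toℕ (proj₁ (remQuot {K} (suc k) i)) ≤ toℕ i
toℕ-quotient≤ {K} k i = begin
  toℕ w                    ≤⟨ ≤-trans (m≤m+n (toℕ w) (k * toℕ w)) (m≤m+n _ (toℕ l)) ⟩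
  suc k * toℕ w + toℕ l    ≡⟨ toℕ-combine w l ⟨
  toℕ (combine w l)        ≡⟨ cong toℕ (combine-remQuot {K} (suc k) i) ⟩
  toℕ i                    ∎
  where
  open ≤-Reasoning
  w = proj₁ (remQuot {K} (suc k) i)
  l = proj₂ (remQuot {K} (suc k) i)

-- Edge counting in an arbitrary realization

flagCount : ℕ → ℕ → Bool → Fin 3 → ℕ
flagCount e₁ e₂ false zero             = e₁
flagCount e₁ e₂ false (suc _)          = 0
flagCount e₁ e₂ true  zero             = 0
flagCount e₁ e₂ true  (suc zero)       = e₂
flagCount e₁ e₂ true  (suc (suc zero)) = 1

replicate-ends↔ : ∀ e (c : CohesiveEnd) β →
  Σ (Fin (length (replicate e c))) (λ k → proj₂ (endAt (replicate e c) k) ≡ β) ↔ (Fin e × (proj₂ c ≡ β))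
replicate-ends↔ e c β = ↔-sym (Σ-↔ (cast-↔ (sym (length-replicate e))) λ {i} →
  ≡-↔ (trans (cong proj₂ (lookup-replicate e c i))) (trans (sym (cong proj₂ (lookup-replicate e c i)))))

tileEnds↔ : ∀ {e₁ e₂} β j → let t = lookup (pot e₁ e₂) j in
  Σ (Fin (length t)) (λ k → proj₂ (endAt t k) ≡ β) ↔ Fin (flagCount e₁ e₂ β j)
tileEnds↔ {e₁} false zero            = ↔-trans (replicate-ends↔ e₁ a false) ×-≡-refl↔
tileEnds↔ {e₁} true  zero            = ↔-trans (replicate-ends↔ e₁ a true) (×-≢↔Fin0 λ ())
tileEnds↔ {e₂ = e₂} false (suc zero) = ↔-trans (replicate-ends↔ e₂ â false) (×-≢↔Fin0 λ ())
tileEnds↔ {e₂ = e₂} true  (suc zero) = ↔-trans (replicate-ends↔ e₂ â true) ×-≡-refl↔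
tileEnds↔ false (suc (suc zero))     = ↔-trans (replicate-ends↔ 1 â false) (×-≢↔Fin0 λ ())
tileEnds↔ true  (suc (suc zero))     = ↔-trans (replicate-ends↔ 1 â true) ×-≡-refl↔

module _ {e₁ e₂ : ℕ} {G : Graph} (ρ : Realization (pot e₁ e₂) G) where

  private
    flag : Fin (m G) × Bool → Bool
    flag h = proj₂ (endOf ρ h)

  countTile↔ : ∀ j → Fin (countTile ρ j) ↔ Fiber (tileOf ρ) j
  countTile↔ j = filter-tabulate↔Σ (λ v → tileOf ρ v ≟ j) uip id

  endOf-assign : ∀ v (x : HalfEdgeAt G v) →
    endOf ρ (proj₁ x) ≡ endAt (lookup (pot e₁ e₂) (tileOf ρ v)) (Inverse.from (assign ρ v) x)
  endOf-assign _ (_ , refl) = refl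

  edges↔tileEnds : ∀ β → Fin (m G) ↔ Fin (sum (λ j → countTile ρ j * flagCount e₁ e₂ β j))
  edges↔tileEnds β = begin
    Fin (m G)
      ↔⟨ ×-⊤↔ ⟨
    (Fin (m G) × ⊤)
      ↔⟨ Σ-↔ ↔-refl (λ {i} → oneSide i) ⟨
    Σ (Fin (m G)) (λ i → flag (i , false) ≡ β ⊎ flag (i , true) ≡ β)
      ↔⟨ Σ-×-Bool↔ _ ⟨
    Σ (Fin (m G) × Bool) (λ h → flag h ≡ β)
      ↔⟨ Σ-fibres↔ (endpoint G) _ ⟩
    Σ (Fin (n G)) (λ v → Σ (HalfEdgeAt G v) (λ x → flag (proj₁ x) ≡ β))
      ↔⟨ Σ-↔ ↔-refl (λ {v} → Σ-↔ (↔-sym (assign ρ v)) λ {x} →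
           ≡-↔ (trans (sym (cong proj₂ (endOf-assign v x)))) (trans (cong proj₂ (endOf-assign v x)))) ⟩
    Σ (Fin (n G)) (λ v → let t = lookup (pot e₁ e₂) (tileOf ρ v) in
                         Σ (Fin (length t)) (λ k → proj₂ (endAt t k) ≡ β))
      ↔⟨ Σ-↔ ↔-refl (tileEnds↔ β _) ⟩
    Σ (Fin (n G)) (λ v → Fin (flagCount e₁ e₂ β (tileOf ρ v)))
      ↔⟨ Σ-∘-fibres↔ (tileOf ρ) (Fin ∘ flagCount e₁ e₂ β) ⟩
    Σ (Fin 3) (λ j → Fiber (tileOf ρ) j × Fin (flagCount e₁ e₂ β j))
      ↔⟨ Σ-↔ ↔-refl (↔-trans (↔-sym (countTile↔ _) ×-↔ ↔-refl) (↔-sym *↔×)) ⟩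
    Σ (Fin 3) (λ j → Fin (countTile ρ j * flagCount e₁ e₂ β j))
      ↔⟨ Σ-Fin↔sum _ ⟩
    Fin (sum (λ j → countTile ρ j * flagCount e₁ e₂ β j)) ∎
    where
    open EquationalReasoning
    oneSide : ∀ i → (flag (i , false) ≡ β ⊎ flag (i , true) ≡ β) ↔ ⊤
    oneSide i = subst (λ b → (flag (i , false) ≡ β ⊎ b ≡ β) ↔ ⊤) (sym (proj₂ (matching ρ i)))
      (≡⊎not≡↔⊤ _ β)

  distribution-balance : ∀ {R₁ R₂ R₃} → HasDistribution ρ R₁ R₂ R₃ → R₁ * e₁ ≡ R₂ * e₂ + R₃
  distribution-balance {R₁} {R₂} {R₃} (d₁ , d₂ , d₃) = begin
    R₁ * e₁                               ≡⟨ solve (R₁ ∷ R₂ ∷ R₃ ∷ e₁ ∷ []) ⟩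
    R₁ * e₁ + (R₂ * 0 + (R₃ * 0 + 0))     ≡⟨ edges false ⟨
    m G                                   ≡⟨ edges true ⟩
    R₁ * 0 + (R₂ * e₂ + (R₃ * 1 + 0))     ≡⟨ solve (R₁ ∷ R₂ ∷ R₃ ∷ e₂ ∷ []) ⟩
    R₂ * e₂ + R₃                          ∎
    where
    open ≡-Reasoning
    edges : ∀ β → m G ≡ R₁ * flagCount e₁ e₂ β zero
                        + (R₂ * flagCount e₁ e₂ β (suc zero) + (R₃ * flagCount e₁ e₂ β (suc (suc zero)) + 0))
    edges β = trans (↔⇒≡ (edges↔tileEnds β))
      (cong₂ _+_ (cong (_* _) d₁) (cong₂ _+_ (cong (_* _) d₂) (cong (λ c → c * _ + 0) d₃)))

-- Bipartite graphs and their realizations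

ConnectedRealization : ℕ → ℕ → ℕ → ℕ → ℕ → Set
ConnectedRealization e₁ e₂ R₁ R₂ R₃ =
  ∃ λ (G : Graph) → Connected G × Σ (Realization (pot e₁ e₂) G) λ ρ → HasDistribution ρ R₁ R₂ R₃

module Bipartite {e₁ e₂ R₁ R₂ R₃ k : ℕ} (src : Fin k → Fin R₁) (tgt : Fin k → Fin R₂ ⊎ Fin R₃) where

  Vertex : Set
  Vertex = Fin R₁ ⊎ (Fin R₂ ⊎ Fin R₃)

  code : Fin (R₁ + (R₂ + R₃)) ↔ Vertex
  code = ↔-trans +↔⊎ (↔-refl ⊎-↔ +↔⊎)

  vertex : Vertex → Fin (R₁ + (R₂ + R₃))
  vertex = Inverse.from code

  code-vertex : ∀ u → Inverse.to code (vertex u) ≡ u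
  code-vertex = Inverse.strictlyInverseˡ code

  vertex≡↔ : ∀ {u v} → (vertex u ≡ v) ↔ (u ≡ Inverse.to code v)
  vertex≡↔ {u} = ≡-↔ (λ { refl → sym (code-vertex u) }) (λ { refl → Inverse.strictlyInverseʳ code _ })

  graph : Graph
  graph = record
    { n        = R₁ + (R₂ + R₃)
    ; m        = k
    ; ends     = λ i → vertex (inj₁ (src i)) , vertex (inj₂ (tgt i))
    ; loopless = λ i eq → inj₁≢inj₂
        (trans (sym (code-vertex (inj₁ (src i)))) (trans (cong (Inverse.to code) eq) (code-vertex (inj₂ (tgt i)))))
    }
    where
    inj₁≢inj₂ : ∀ {x : Fin R₁} {y} → inj₁ x ≢ inj₂ y
    inj₁≢inj₂ ()

  tileIndex : Vertex → Fin 3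
  tileIndex (inj₁ _)        = zero
  tileIndex (inj₂ (inj₁ _)) = suc zero
  tileIndex (inj₂ (inj₂ _)) = suc (suc zero)

  vertexEnd : Vertex → CohesiveEnd
  vertexEnd (inj₁ _) = a
  vertexEnd (inj₂ _) = â

  tile-ends : ∀ u k → endAt (lookup (pot e₁ e₂) (tileIndex u)) k ≡ vertexEnd u
  tile-ends (inj₁ _)        = lookup-replicate′ e₁ a
  tile-ends (inj₂ (inj₁ _)) = lookup-replicate′ e₂ â
  tile-ends (inj₂ (inj₂ _)) = lookup-replicate′ 1 â

  hatDegree : Fin R₂ ⊎ Fin R₃ → ℕ
  hatDegree (inj₁ _) = e₂
  hatDegree (inj₂ _) = 1

  halfEdgesAt↔ : ∀ v → HalfEdgeAt graph v ↔
    Σ (Fin k) (λ i → inj₁ (src i) ≡ Inverse.to code v ⊎ inj₂ (tgt i) ≡ Inverse.to code v)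
  halfEdgesAt↔ v = ↔-trans (Σ-×-Bool↔ _) (Σ-↔ ↔-refl (vertex≡↔ ⊎-↔ vertex≡↔))

  Fiber-tileIndex₁ : Fiber tileIndex zero ↔ Fin R₁
  Fiber-tileIndex₁ = mk↔ₛ′ (λ { (inj₁ x , refl) → x ; (inj₂ (inj₁ _) , ()) ; (inj₂ (inj₂ _) , ()) })
    (λ x → inj₁ x , refl) (λ _ → refl)
    (λ { (inj₁ _ , refl) → refl ; (inj₂ (inj₁ _) , ()) ; (inj₂ (inj₂ _) , ()) })

  Fiber-tileIndex₂ : Fiber tileIndex (suc zero) ↔ Fin R₂
  Fiber-tileIndex₂ = mk↔ₛ′ (λ { (inj₂ (inj₁ y) , refl) → y ; (inj₁ _ , ()) ; (inj₂ (inj₂ _) , ()) })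
    (λ y → inj₂ (inj₁ y) , refl) (λ _ → refl)
    (λ { (inj₂ (inj₁ _) , refl) → refl ; (inj₁ _ , ()) ; (inj₂ (inj₂ _) , ()) })

  Fiber-tileIndex₃ : Fiber tileIndex (suc (suc zero)) ↔ Fin R₃
  Fiber-tileIndex₃ = mk↔ₛ′ (λ { (inj₂ (inj₂ y) , refl) → y ; (inj₁ _ , ()) ; (inj₂ (inj₁ _) , ()) })
    (λ y → inj₂ (inj₂ y) , refl) (λ _ → refl)
    (λ { (inj₂ (inj₂ _) , refl) → refl ; (inj₁ _ , ()) ; (inj₂ (inj₁ _) , ()) })

  module _ (src-fiber : ∀ x → Fiber src x ↔ Fin e₁) (tgt-fiber : ∀ y → Fiber tgt y ↔ Fin (hatDegree y)) where

    degree↔ : ∀ u → Fin (length (lookup (pot e₁ e₂) (tileIndex u))) ↔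
      Σ (Fin k) (λ i → inj₁ (src i) ≡ u ⊎ inj₂ (tgt i) ≡ u)
    degree↔ (inj₁ x) = ↔-trans (cast-↔ (length-replicate e₁))
      (↔-trans (↔-sym (src-fiber x)) (Σ-↔ ↔-refl inj₁-side↔))
    degree↔ (inj₂ y) = ↔-trans (tileLength y) (↔-trans (↔-sym (tgt-fiber y)) (Σ-↔ ↔-refl inj₂-side↔))
      where
      tileLength : ∀ y → Fin (length (lookup (pot e₁ e₂) (tileIndex (inj₂ y)))) ↔ Fin (hatDegree y)
      tileLength (inj₁ _) = cast-↔ (length-replicate e₂)
      tileLength (inj₂ _) = ↔-refl

    realization : Realization (pot e₁ e₂) graph
    realization = record
      { tileOf   = tileIndex ∘ Inverse.to code
      ; assign   = λ v → ↔-trans (degree↔ (Inverse.to code v)) (↔-sym (halfEdgesAt↔ v))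
      ; matching = λ i → subst₂ complementary
          (sym (trans (tile-ends _ _) (cong vertexEnd (code-vertex (inj₁ (src i))))))
          (sym (trans (tile-ends _ _) (cong vertexEnd (code-vertex (inj₂ (tgt i))))))
          (refl , refl)
      }

    distribution : HasDistribution realization R₁ R₂ R₃
    distribution = count Fiber-tileIndex₁ , count Fiber-tileIndex₂ , count Fiber-tileIndex₃
      where
      count : ∀ {j R} → Fiber tileIndex j ↔ Fin R → countTile realization j ≡ R
      count {j} fiber = ↔⇒≡ (↔-trans (countTile↔ realization j) (↔-trans (Fiber-∘↔ code tileIndex j) fiber))

  edge-adjacent : ∀ i → Adjacent graph (vertex (inj₁ (src i))) (vertex (inj₂ (tgt i)))
  edge-adjacent i = i , inj₁ refl

  adjacent-sym : ∀ {u v} → Adjacent graph u v → Adjacent graph v u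
  adjacent-sym (i , inj₁ eq) = i , inj₂ eq
  adjacent-sym (i , inj₂ eq) = i , inj₁ eq

  common-hat : ∀ {x x′} i j → src i ≡ x → src j ≡ x′ → tgt i ≡ tgt j →
    Star (Adjacent graph) (vertex (inj₁ x)) (vertex (inj₁ x′))
  common-hat i j refl refl eq =
    edge-adjacent i ◅ (j , inj₂ (cong (λ y → vertex (inj₁ (src j)) , vertex (inj₂ y)) (sym eq))) ◅ ε

  connected : (∀ y → Fiber tgt y ↔ Fin (hatDegree y)) → Fin e₂ → (root : Fin R₁) →
    (∀ x → Star (Adjacent graph) (vertex (inj₁ root)) (vertex (inj₁ x))) → Connected graph
  connected tgt-fiber slot root reach-left u v = reverse adjacent-sym (reach u) ◅◅ reach v
    where
    someSlot : ∀ y → Fin (hatDegree y)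
    someSlot (inj₁ _) = slot
    someSlot (inj₂ _) = zero

    reach-vertex : ∀ u → Star (Adjacent graph) (vertex (inj₁ root)) (vertex u)
    reach-vertex (inj₁ x) = reach-left x
    reach-vertex (inj₂ y) with Inverse.from (tgt-fiber y) (someSlot y)
    ... | i , refl = reach-left (src i) ◅◅ edge-adjacent i ◅ ε

    reach : ∀ v → Star (Adjacent graph) (vertex (inj₁ root)) v
    reach v = subst (Star (Adjacent graph) _) (Inverse.strictlyInverseʳ code v) (reach-vertex (Inverse.to code v))

empty-realization : ∀ {e₁ e₂} → ConnectedRealization e₁ e₂ 0 0 0
empty-realization = graph , (λ ()) , realization (λ ()) (λ { (inj₁ ()) ; (inj₂ ()) }) ,
  distribution (λ ()) (λ { (inj₁ ()) ; (inj₂ ()) })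
  where open Bipartite {R₁ = 0} {R₂ = 0} {R₃ = 0} {k = 0} (λ ()) (λ ())

-- The hub construction

-- Here R₁ = 1 + L, e₁ = 2 + e₁′, e₂ = 1 + d with d = 1 + d′, and R₂ = K + r₂. The a-vertices
-- of index < K give their second end to a hub, the other r keep it spare; of the K d child
-- slots of the hubs, L are used and s stay spare.
module HubConstruction (L K r s r₂ R₃ e₁′ d′ : ℕ)
  (hubs : K + r ≡ suc L) (children : L + s ≡ K * suc d′)
  (balance : suc L * suc (suc e₁′) ≡ (K + r₂) * suc (suc d′) + R₃) where

  spares : suc (r + suc L * e₁′) ≡ s + (r₂ * suc (suc d′) + R₃)
  spares = +-cancelˡ-≡ (L + K) _ _ (begin
    L + K + suc (r + suc L * e₁′)              ≡⟨ solve (L ∷ K ∷ r ∷ e₁′ ∷ []) ⟩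
    (K + r) + suc (L + suc L * e₁′)            ≡⟨ cong (_+ suc (L + suc L * e₁′)) hubs ⟩
    suc L + suc (L + suc L * e₁′)              ≡⟨ solve (L ∷ e₁′ ∷ []) ⟩
    suc L * suc (suc e₁′)                      ≡⟨ balance ⟩
    (K + r₂) * suc (suc d′) + R₃               ≡⟨ solve (K ∷ r₂ ∷ R₃ ∷ d′ ∷ []) ⟩
    K + K * suc d′ + (r₂ * suc (suc d′) + R₃)  ≡⟨ cong (λ x → K + x + (r₂ * suc (suc d′) + R₃)) children ⟨
    K + (L + s) + (r₂ * suc (suc d′) + R₃)     ≡⟨ solve (L ∷ K ∷ s ∷ r₂ ∷ R₃ ∷ d′ ∷ []) ⟩
    L + K + (s + (r₂ * suc (suc d′) + R₃))     ∎)
    where open ≡-Reasoning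

  hubs↔ : (Fin K ⊎ Fin r) ↔ Fin (suc L)
  hubs↔ = ↔-trans (↔-sym +↔⊎) (cast-↔ hubs)

  childSlots↔ : (Fin L ⊎ Fin s) ↔ (Fin K × Fin (suc d′))
  childSlots↔ = ↔-trans (↔-sym +↔⊎) (↔-trans (cast-↔ children) *↔×)

  spareAEnds↔ : Fin (suc (r + suc L * e₁′)) ↔ (⊤ ⊎ (Fin r ⊎ (Fin (suc L) × Fin e₁′)))
  spareAEnds↔ = ↔-trans Fin-suc↔ (↔-refl ⊎-↔ ↔-trans +↔⊎ (↔-refl ⊎-↔ *↔×))

  spareHatEnds↔ : Fin (suc (r + suc L * e₁′)) ↔ (Fin s ⊎ ((Fin r₂ × Fin (suc (suc d′))) ⊎ Fin R₃))
  spareHatEnds↔ = ↔-trans (cast-↔ spares) (↔-trans +↔⊎ (↔-refl ⊎-↔ ↔-trans +↔⊎ (*↔× ⊎-↔ ↔-refl)))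

  -- A child p joins a-vertex 1 + p to a hub, a hub edge w joins a-vertex w to hub w, and the
  -- spare edges pair up the remaining a-ends (the first end of a-vertex 0, the second ends of
  -- the non-hub a-vertices, all further ends) with the remaining â-ends.
  Edge : Set
  Edge = Fin L ⊎ (Fin K ⊎ Fin (suc (r + suc L * e₁′)))

  aHalfEdges↔ : Edge ↔ (Fin (suc L) × Fin (suc (suc e₁′)))
  aHalfEdges↔ = begin
    Edge
      ↔⟨ ↔-refl ⊎-↔ (↔-refl ⊎-↔ spareAEnds↔) ⟩
    (Fin L ⊎ (Fin K ⊎ (⊤ ⊎ (Fin r ⊎ (Fin (suc L) × Fin e₁′)))))
      ↔⟨ shuffle ⟩
    ((⊤ ⊎ Fin L) ⊎ ((Fin K ⊎ Fin r) ⊎ (Fin (suc L) × Fin e₁′)))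
      ↔⟨ ↔-sym Fin-suc↔ ⊎-↔ (hubs↔ ⊎-↔ ↔-refl) ⟩
    (Fin (suc L) ⊎ (Fin (suc L) ⊎ (Fin (suc L) × Fin e₁′)))
      ↔⟨ ↔-refl ⊎-↔ ×-Fin-suc↔ ⟨
    (Fin (suc L) ⊎ (Fin (suc L) × Fin (suc e₁′)))
      ↔⟨ ×-Fin-suc↔ ⟨
    (Fin (suc L) × Fin (suc (suc e₁′))) ∎
    where
    open EquationalReasoning
    shuffle : (A ⊎ (B ⊎ (C ⊎ (D ⊎ E)))) ↔ ((C ⊎ A) ⊎ ((B ⊎ D) ⊎ E))
    shuffle = mk↔ₛ′
      (λ { (inj₁ x)                     → inj₁ (inj₂ x)
         ; (inj₂ (inj₁ y))              → inj₂ (inj₁ (inj₁ y))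
         ; (inj₂ (inj₂ (inj₁ z)))        → inj₁ (inj₁ z)
         ; (inj₂ (inj₂ (inj₂ (inj₁ u)))) → inj₂ (inj₁ (inj₂ u))
         ; (inj₂ (inj₂ (inj₂ (inj₂ v)))) → inj₂ (inj₂ v) })
      (λ { (inj₁ (inj₂ x))        → inj₁ x
         ; (inj₂ (inj₁ (inj₁ y))) → inj₂ (inj₁ y)
         ; (inj₁ (inj₁ z))        → inj₂ (inj₂ (inj₁ z))
         ; (inj₂ (inj₁ (inj₂ u))) → inj₂ (inj₂ (inj₂ (inj₁ u)))
         ; (inj₂ (inj₂ v))        → inj₂ (inj₂ (inj₂ (inj₂ v))) })
      (λ { (inj₁ (inj₂ _)) → refl ; (inj₂ (inj₁ (inj₁ _))) → refl ; (inj₁ (inj₁ _)) → refl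
         ; (inj₂ (inj₁ (inj₂ _))) → refl ; (inj₂ (inj₂ _)) → refl })
      (λ { (inj₁ _) → refl ; (inj₂ (inj₁ _)) → refl ; (inj₂ (inj₂ (inj₁ _))) → refl
         ; (inj₂ (inj₂ (inj₂ (inj₁ _)))) → refl ; (inj₂ (inj₂ (inj₂ (inj₂ _)))) → refl })

  HatHalfEdge : Set
  HatHalfEdge = (Fin (K + r₂) × Fin (suc (suc d′))) ⊎ Fin R₃

  hatHalfEdges↔ : Edge ↔ HatHalfEdge
  hatHalfEdges↔ = begin
    Edge
      ↔⟨ ↔-refl ⊎-↔ (↔-refl ⊎-↔ spareHatEnds↔) ⟩
    (Fin L ⊎ (Fin K ⊎ (Fin s ⊎ ((Fin r₂ × Fin (suc (suc d′))) ⊎ Fin R₃))))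
      ↔⟨ shuffle ⟩
    (((Fin K ⊎ (Fin L ⊎ Fin s)) ⊎ (Fin r₂ × Fin (suc (suc d′)))) ⊎ Fin R₃)
      ↔⟨ ((↔-refl ⊎-↔ childSlots↔) ⊎-↔ ↔-refl) ⊎-↔ ↔-refl ⟩
    (((Fin K ⊎ (Fin K × Fin (suc d′))) ⊎ (Fin r₂ × Fin (suc (suc d′)))) ⊎ Fin R₃)
      ↔⟨ (×-Fin-suc↔ ⊎-↔ ↔-refl) ⊎-↔ ↔-refl ⟨
    (((Fin K × Fin (suc (suc d′))) ⊎ (Fin r₂ × Fin (suc (suc d′)))) ⊎ Fin R₃)
      ↔⟨ ×-distribʳ-⊎ 0ℓ _ _ _ ⊎-↔ ↔-refl ⟨
    (((Fin K ⊎ Fin r₂) × Fin (suc (suc d′))) ⊎ Fin R₃)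
      ↔⟨ (+↔⊎ ×-↔ ↔-refl) ⊎-↔ ↔-refl ⟨
    HatHalfEdge ∎
    where
    open EquationalReasoning
    shuffle : (A ⊎ (B ⊎ (C ⊎ (D ⊎ E)))) ↔ (((B ⊎ (A ⊎ C)) ⊎ D) ⊎ E)
    shuffle = mk↔ₛ′
      (λ { (inj₁ x)                     → inj₁ (inj₁ (inj₂ (inj₁ x)))
         ; (inj₂ (inj₁ y))              → inj₁ (inj₁ (inj₁ y))
         ; (inj₂ (inj₂ (inj₁ z)))        → inj₁ (inj₁ (inj₂ (inj₂ z)))
         ; (inj₂ (inj₂ (inj₂ (inj₁ u)))) → inj₁ (inj₂ u)
         ; (inj₂ (inj₂ (inj₂ (inj₂ v)))) → inj₂ v })
      (λ { (inj₁ (inj₁ (inj₂ (inj₁ x)))) → inj₁ x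
         ; (inj₁ (inj₁ (inj₁ y)))        → inj₂ (inj₁ y)
         ; (inj₁ (inj₁ (inj₂ (inj₂ z)))) → inj₂ (inj₂ (inj₁ z))
         ; (inj₁ (inj₂ u))              → inj₂ (inj₂ (inj₂ (inj₁ u)))
         ; (inj₂ v)                     → inj₂ (inj₂ (inj₂ (inj₂ v))) })
      (λ { (inj₁ (inj₁ (inj₂ (inj₁ _)))) → refl ; (inj₁ (inj₁ (inj₁ _))) → refl
         ; (inj₁ (inj₁ (inj₂ (inj₂ _)))) → refl ; (inj₁ (inj₂ _)) → refl ; (inj₂ _) → refl })
      (λ { (inj₁ _) → refl ; (inj₂ (inj₁ _)) → refl ; (inj₂ (inj₂ (inj₁ _))) → refl
         ; (inj₂ (inj₂ (inj₂ (inj₁ _)))) → refl ; (inj₂ (inj₂ (inj₂ (inj₂ _)))) → refl })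

  hat : HatHalfEdge → Fin (K + r₂) ⊎ Fin R₃
  hat = map proj₁ id

  edgeCode : Fin (L + (K + suc (r + suc L * e₁′))) ↔ Edge
  edgeCode = ↔-trans +↔⊎ (↔-refl ⊎-↔ +↔⊎)

  src : Fin (L + (K + suc (r + suc L * e₁′))) → Fin (suc L)
  src = proj₁ ∘ Inverse.to (↔-trans edgeCode aHalfEdges↔)

  tgt : Fin (L + (K + suc (r + suc L * e₁′))) → Fin (K + r₂) ⊎ Fin R₃
  tgt = hat ∘ Inverse.to (↔-trans edgeCode hatHalfEdges↔)

  open Bipartite {e₁ = suc (suc e₁′)} {e₂ = suc (suc d′)} src tgt

  src-fiber : ∀ x → Fiber src x ↔ Fin (suc (suc e₁′))
  src-fiber x = ↔-trans (Fiber-∘↔ (↔-trans edgeCode aHalfEdges↔) proj₁ x) (Fiber-proj₁↔ x)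

  tgt-fiber : ∀ y → Fiber tgt y ↔ Fin (hatDegree y)
  tgt-fiber y = ↔-trans (Fiber-∘↔ (↔-trans edgeCode hatHalfEdges↔) hat y) (hat-fiber y)
    where
    hat-fiber : ∀ y → Fiber hat y ↔ Fin (hatDegree y)
    hat-fiber (inj₁ b) = mk↔ₛ′ (λ { (inj₁ (_ , l) , refl) → l ; (inj₂ _ , ()) })
      (λ l → inj₁ (b , l) , refl) (λ _ → refl) (λ { (inj₁ _ , refl) → refl ; (inj₂ _ , ()) })
    hat-fiber (inj₂ c) = mk↔ₛ′ (λ _ → zero) (λ _ → inj₂ c , refl)
      (λ { zero → refl }) (λ { (inj₂ _ , refl) → refl ; (inj₁ _ , ()) })

  hubOf : Fin L → Fin K
  hubOf p = proj₁ (remQuot (suc d′) (cast children (p ↑ˡ s)))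

  hubOf≤ : ∀ p → toℕ (hubOf p) ≤ toℕ p
  hubOf≤ p = ≤-trans (toℕ-quotient≤ d′ (cast children (p ↑ˡ s)))
    (≤-reflexive (trans (toℕ-cast children (p ↑ˡ s)) (toℕ-↑ˡ p s)))

  hubVertex : Fin K → Fin (suc L)
  hubVertex w = cast hubs (w ↑ˡ r)

  hub-child : ∀ p → Star (Adjacent graph) (vertex (inj₁ (hubVertex (hubOf p)))) (vertex (inj₁ (suc p)))
  hub-child p = common-hat (Inverse.from edgeCode hubEdge) (Inverse.from edgeCode childEdge)
    (cong (proj₁ ∘ Inverse.to aHalfEdges↔) (Inverse.strictlyInverseˡ edgeCode hubEdge))
    (cong (proj₁ ∘ Inverse.to aHalfEdges↔) (Inverse.strictlyInverseˡ edgeCode childEdge))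
    (trans (cong (hat ∘ Inverse.to hatHalfEdges↔) (Inverse.strictlyInverseˡ edgeCode hubEdge))
           (sym (cong (hat ∘ Inverse.to hatHalfEdges↔) (Inverse.strictlyInverseˡ edgeCode childEdge))))
    where
    hubEdge childEdge : Edge
    hubEdge   = inj₂ (inj₁ (hubOf p))
    childEdge = inj₁ p

  reach-a-vertex : ∀ x → Star (Adjacent graph) (vertex (inj₁ zero)) (vertex (inj₁ x))
  reach-a-vertex x = below (suc (toℕ x)) x ≤-refl′
    where
    ≤-refl′ = s≤s (≤-reflexive refl)
    below : ∀ n x → toℕ x < n → Star (Adjacent graph) (vertex (inj₁ zero)) (vertex (inj₁ x))
    below (suc n) zero    _         = ε
    below (suc n) (suc p) (s≤s p<n) = below n (hubVertex (hubOf p)) hub<n ◅◅ hub-child p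
      where
      hub<n : toℕ (hubVertex (hubOf p)) < n
      hub<n = ≤-<-trans (≤-trans (≤-reflexive (trans (toℕ-cast hubs _) (toℕ-↑ˡ _ r))) (hubOf≤ p)) p<n

  connected-realization : ConnectedRealization (suc (suc e₁′)) (suc (suc d′)) (suc L) (K + r₂) R₃
  connected-realization = graph , connected tgt-fiber zero zero reach-a-vertex ,
    realization src-fiber tgt-fiber , distribution src-fiber tgt-fiber

theorem5 : (e₁ e₂ : ℕ) → 1 < e₂ → e₂ ≤ e₁ → (R₁ R₂ R₃ : ℕ) →
    (∃ λ (G : Graph) → Σ (Realization (pot e₁ e₂) G) λ ρ → HasDistribution ρ R₁ R₂ R₃) →
    R₁ ≤ 1 + R₂ * (e₂ ∸ 1) →
    ∃ λ (G : Graph) → Connected G × Σ (Realization (pot e₁ e₂) G) λ ρ → HasDistribution ρ R₁ R₂ R₃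
theorem5 (suc (suc e₁′)) (suc (suc d′)) (s≤s (s≤s z≤n)) (s≤s (s≤s _)) zero R₂ R₃ (_ , ρ , dist) _ =
  subst₂ (ConnectedRealization (suc (suc e₁′)) (suc (suc d′)) 0) (sym R₂≡0) (sym R₃≡0) empty-realization
  where
  no-edges : 0 ≡ R₂ * suc (suc d′) + R₃
  no-edges = distribution-balance ρ dist
  R₂≡0 = m*n≡0⇒m≡0 R₂ (suc (suc d′)) (m+n≡0⇒m≡0 (R₂ * suc (suc d′)) (sym no-edges))
  R₃≡0 = m+n≡0⇒n≡0 (R₂ * suc (suc d′)) (sym no-edges)
theorem5 (suc (suc e₁′)) (suc (suc d′)) (s≤s (s≤s z≤n)) (s≤s (s≤s _)) (suc L) R₂ R₃ (_ , ρ , dist)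
  (s≤s L≤R₂d) =
  subst (λ R₂ → ConnectedRealization (suc (suc e₁′)) (suc (suc d′)) (suc L) R₂ R₃) blocks
    (HubConstruction.connected-realization L K (suc L ∸ K) (K * suc d′ ∸ L) (R₂ ∸ K) R₃ e₁′ d′
      hubs children (subst (λ R₂ → suc L * suc (suc e₁′) ≡ R₂ * suc (suc d′) + R₃) (sym blocks)
                       (distribution-balance ρ dist)))
  where
  K = L ⊓ R₂
  hubs : K + (suc L ∸ K) ≡ suc L
  hubs = m+[n∸m]≡n (≤-trans (m⊓n≤m L R₂) (n≤1+n L))
  children : L + (K * suc d′ ∸ L) ≡ K * suc d′
  children = m+[n∸m]≡n
    (subst (L ≤_) (sym (*-distribʳ-⊓ (suc d′) L R₂)) (⊓-glb (m≤m*n L (suc d′)) L≤R₂d))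
  blocks : K + (R₂ ∸ K) ≡ R₂
  blocks = m+[n∸m]≡n (m⊓n≤n L R₂)
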